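{- In any of the calculi CCS, ABC, ABCd, CCSS, CCSS$'$ described below, if $t,t'\in\mathit{Tr}^{s\bullet}$, $v\in\mathit{Tr}$, $t\leadsto t'$ and $t\smile^{\bullet}v$, then $t'\smile^{\bullet}v$.
   Context: Fix sets $\mathcal A$ (agent identifiers), $\mathcal C$ (handshake names), $\mathcal B$ (broadcast names), $\mathcal S$ (signals); $\bar{\mathcal C}=\{\bar c\mid c\in\mathcal C\}$, $\bar{\mathcal S}=\{\bar s\mid s\in\mathcal S\}$, $\bar{\bar x}=x$. Processes: $P::=\mathbf 0\mid\alpha.P\mid P+P\mid P|P\mid P\backslash L\mid P[f]\mid A$, and in CCSS, CCSS$'$ also $P\,\hat{}\,s$ ($s\in\mathcal S$); each $A\in\mathcal A$ has an equation $A\stackrel{def}{=}P_A$ (guarded in ABC, ABCd); $L\subseteq\mathcal C$ ($L\subseteq\mathcal C\cup\mathcal S$ in CCSS, CCSS$'$); $f$ maps $\mathcal C\to\mathcal C$, $\mathcal B\to\mathcal B$, $\mathcal S\to\mathcal S$, extended by $f(\bar c)=\overline{f(c)}$, $f(b!)=f(b)!$, $f(b?)=f(b)?$, $f(\tau)=\tau$. Actions/labels: CCS: $\mathit{Act}=\mathcal L=\mathcal C\cup\bar{\mathcal C}\cup\{\tau\}$; ABC: $\mathit{Act}=\mathcal L=\{b!,b?\mid b\in\mathcal B\}\cup\mathcal C\cup\bar{\mathcal C}\cup\{\tau\}$; ABCd: same $\mathit{Act}$, $\mathcal L=\mathit{Act}\cup\{b{:}\mid b\in\mathcal B\}$; CCSS: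 $\mathit{Act}=\mathcal L=\mathcal S\cup\mathcal C\cup\bar{\mathcal C}\cup\{\tau\}$; CCSS$'$: same $\mathit{Act}$, $\mathcal L=\mathit{Act}\cup\bar{\mathcal S}$. $R=\{b?\mid b\in\mathcal B\}$ in ABC, ABCd, $R=\emptyset$ otherwise. Rules (all calculi): $\alpha.P\xrightarrow{\alpha}P$; from $P\xrightarrow{\alpha}P'$: $P+Q\xrightarrow{\alpha}P'$, $Q+P\xrightarrow{\alpha}P'$; from $P\xrightarrow{\eta}P'$: $P|Q\xrightarrow{\eta}P'|Q$, $Q|P\xrightarrow{\eta}Q|P'$; from $P\xrightarrow{c}P'$, $Q\xrightarrow{\bar c}Q'$: $P|Q\xrightarrow{\tau}P'|Q'$; from $P\xrightarrow{\ell}P'$: $P\backslash L\xrightarrow{\ell}P'\backslash L$ if $\ell\notin L\cup\bar L$, and $P[f]\xrightarrow{f(\ell)}P'[f]$; from $P_A\xrightarrow{\alpha}P'$: $A\xrightarrow{\alpha}P'$. Here $\alpha\in\mathit{Act}$, $\ell\in\mathcal L$, $c\in\mathcal C\cup\bar{\mathcal C}$ (in CCSS$'$ also $\mathcal S\cup\bar{\mathcal S}$), $\eta$ over $\mathcal C\cup\bar{\mathcal C}\cup\{\tau\}$ in ABC/ABCd, over $\mathit{Act}$ in CCS/CCSS, over $\mathcal L$ in CCSS$'$. ABC adds: from $P\xrightarrow{b\sharp_1}P'$ and $Q$ with no $b?$-transition: $P|Q\xrightarrow{b\sharp_1}P'|Q$, $Q|P\xrightarrow{b\sharp_1}Q|P'$;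 from $P\xrightarrow{b\sharp_1}P'$, $Q\xrightarrow{b\sharp_2}Q'$: $P|Q\xrightarrow{b\sharp}P'|Q'$, $\sharp=\sharp_1\circ\sharp_2$ with $!\circ?=?\circ!=!$, $?\circ?=?$, $!\circ!$ undefined. ABCd adds (instead): $\mathbf 0\xrightarrow{b:}\mathbf 0$; $\alpha.P\xrightarrow{b:}\alpha.P$ ($\alpha\ne b?$); from $P\xrightarrow{b:}P'$, $Q\xrightarrow{b:}Q'$: $P+Q\xrightarrow{b:}P'+Q'$; the synchronisation rule with $\sharp_i\in\{!,?,:\}$, additionally $!\circ:=:\circ!=!$, $?\circ:=:\circ?=?$, $:\circ:=:$; from $P_A\xrightarrow{b:}P'$: $A\xrightarrow{b:}A$. CCSS adds a predicate $P\curvearrowright s$: $(P\,\hat{}\,s)\curvearrowright s$; from $P\curvearrowright s$: $(P+Q),(Q+P),(P|Q),(Q|P),(P\,\hat{}\,r)\curvearrowright s$, $(P\backslash L)\curvearrowright s$ if $s\notin L$, $P[f]\curvearrowright f(s)$, $A\curvearrowright s$ if $P=P_A$; transitions: from $P\xrightarrow{\alpha}P'$: $P\,\hat{}\,r\xrightarrow{\alpha}P'$; from $P\curvearrowright s$, $Q\xrightarrow{s}Q'$: $P|Q\xrightarrow{\tau}P|Q'$; from $P\xrightarrow{s}P'$, $Q\curvearrowright s$: $P|Q\xrightarrow{\tau}P'|Q$. CCSS$'$ adds: $P\,\hat{}\,s\xrightarrow{\bar s}P\,\hat{}\,s$; from $P\xrightarrow{\bar s}P'$: $P+Q\xrightarrow{\bar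 s}P'+Q$, $Q+P\xrightarrow{\bar s}Q+P'$, $P\,\hat{}\,r\xrightarrow{\bar s}P'\,\hat{}\,r$; from $P\xrightarrow{\alpha}P'$: $P\,\hat{}\,r\xrightarrow{\alpha}P'$; from $P_A\xrightarrow{\bar s}P'$: $A\xrightarrow{\bar s}A$. $\mathit{Tr}$: derivations (proof trees) of transitions, with source, target, label of the derived transition; named $\overset{\alpha}{\to}P$ (prefix axiom), $\chi+Q$, $P+\chi$, $\chi|Q$, $P|\zeta$, $\chi|\zeta$ (any binary synchronisation), $\chi\backslash L$, $\chi[f]$, $A{:}\chi$, $\chi\,\hat{}\,r$; emission derivations $P\!\uparrow\!s$ (axiom) and lifted ones named likewise; ABCd: $b{:}\mathbf 0$, $b{:}\alpha.P$, $\chi+v$. An emission derivation of $P\curvearrowright s$ has source $P$, label $\bar s$. $\mathit{Tr}^\bullet$: derivations with label in $\mathit{Act}\setminus R$. $\mathit{Tr}^{s\bullet}$: emission derivations, transition derivations labelled in $\bar{\mathcal S}$, and those labelled in $\mathit{Act}\setminus\{b?\mid b\in\mathcal B\}$. Synchrons: $\mathit{Arg}=\{+_L,+_R,|_L,|_R,\backslash L,[f],A{:},\hat{}\,r\}$; a synchron is $\sigma(\overset{\alpha}{\to}P)$, $\sigma(P\!\uparrow\!s)$ or $\sigma(b{:})$, $\sigma\in\mathit{Arg}^*$. $\varsigma(\overset{\alpha}{\to}P)=\{(\overset{\alpha}{\to}P)\}$, $\varsigma(P\!\uparrow\!s)=\{(P\!\uparrow\!s)\}$, $\varsigma(b{:}\mathbf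 0)=\varsigma(b{:}\alpha.P)=\{(b{:})\}$, $\varsigma(\chi+Q)=+_L\varsigma(\chi)$, $\varsigma(P+\chi)=+_R\varsigma(\chi)$, $\varsigma(\chi+v)=+_L\varsigma(\chi)\cup+_R\varsigma(v)$, $\varsigma(\chi|Q)=|_L\varsigma(\chi)$, $\varsigma(P|\zeta)=|_R\varsigma(\zeta)$, $\varsigma(\chi|\zeta)=|_L\varsigma(\chi)\cup|_R\varsigma(\zeta)$, $\varsigma(\chi\backslash L)=\backslash L\,\varsigma(\chi)$, $\varsigma(\chi[f])=[f]\varsigma(\chi)$, $\varsigma(A{:}\chi)=A{:}\varsigma(\chi)$, $\varsigma(\chi\,\hat{}\,r)=\hat{}\,r\,\varsigma(\chi)$ (arguments applied elementwise). $a\varsigma(\chi)$: synchrons of form $\sigma(\overset{\alpha}{\to}P)$. For $\chi\in\mathit{Tr}^{s\bullet}$: $n\varsigma(\chi)$ is the unique synchron of form $\sigma(\overset{b!}{\to}P)$ if $\ell(\chi)=b!$, and $\varsigma(\chi)$ otherwise. $+_L,+_R,A{:},\hat{}\,r$ are dynamic, the others static; $\mathrm{static}(\sigma)$ deletes dynamic arguments. For strings: $x\leadsto x'$ iff $x'=x$ or $x=\sigma_1|_Dx_2$, $x'=\mathrm{static}(\sigma_1)|_Dx_2$; $x\smile_dy$ iff $x=\sigma_1|_Dx_2$, $y=\sigma_1|_Ey_2$, $\{D,E\}=\{L,R\}$; $x\smile y$ iff $x_0\leadsto x$, $x_0\smile_dy_0$, $y_0\leadsto y$ for some $x_0,y_0$.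 For $\chi,\chi'\in\mathit{Tr}^{s\bullet}$: $\chi\leadsto\chi'$ iff $|n\varsigma(\chi)|=|n\varsigma(\chi')|$ and each $\varsigma'\in n\varsigma(\chi')$ has $\varsigma\in n\varsigma(\chi)$ with $\varsigma\leadsto\varsigma'$. For $\chi\in\mathit{Tr}^{s\bullet}$, $\zeta\in\mathit{Tr}$: $\chi\smile^{\bullet}\zeta$ iff $\varsigma\smile\upsilon$ for all $\varsigma\in n\varsigma(\chi)$, $\upsilon\in a\varsigma(\zeta)$. -}

module Defs where

open import Data.Unit using (⊤; tt)
open import Data.Empty using (⊥)
open import Data.Sum using (_⊎_; inj₁; inj₂)
open import Data.Product using (Σ; _×_; _,_; ∃; proj₁; proj₂)
open import Data.List using (List; []; _∷_; _++_; map; length)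
open import Data.List.Membership.Propositional using (_∈_)
open import Relation.Binary.PropositionalEquality using (_≡_)
open import Relation.Nullary using (¬_)

data Calc : Set where
  CCS ABC ABCd CCSS CCSS′ : Calc

-- broadcast actions b!, b? exist (ABC, ABCd)
HasB : Calc → Set
HasB ABC  = ⊤
HasB ABCd = ⊤
HasB _    = ⊥

-- signal actions s ∈ 𝒮 and the signalling operator P ^ s exist (CCSS, CCSS′)
HasS : Calc → Set
HasS CCSS  = ⊤
HasS CCSS′ = ⊤
HasS _     = ⊥

-- discard labels b: exist (ABCd)
HasD : Calc → Set
HasD ABCd = ⊤
HasD _    = ⊥

-- signal-emission labels s̄ are transition labels (CCSS′)
HasCo : Calc → Set
HasCo CCSS′ = ⊤
HasCo _     = ⊥

IsABC : Calc → Set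
IsABC ABC = ⊤
IsABC _   = ⊥

IsCCSS : Calc → Set
IsCCSS CCSS = ⊤
IsCCSS _    = ⊥

module _ (𝒜 𝒞 ℬ 𝒮 : Set) where

  -- restriction sets: L ⊆ 𝒞, or L ⊆ 𝒞 ∪ 𝒮 in CCSS, CCSS′ (as predicates)

  RSet : Calc → Set₁
  RSet CCSS  = 𝒞 ⊎ 𝒮 → Set
  RSet CCSS′ = 𝒞 ⊎ 𝒮 → Set
  RSet CCS   = 𝒞 → Set
  RSet ABC   = 𝒞 → Set
  RSet ABCd  = 𝒞 → Set

  private
    onlyC : (𝒞 → Set) → 𝒞 ⊎ 𝒮 → Set
    onlyC L (inj₁ c) = L c
    onlyC L (inj₂ _) = ⊥

  InL : (k : Calc) → RSet k → 𝒞 ⊎ 𝒮 → Set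
  InL CCSS  L x = L x
  InL CCSS′ L x = L x
  InL CCS   L x = onlyC L x
  InL ABC   L x = onlyC L x
  InL ABCd  L x = onlyC L x

  record Relab : Set where
    field
      fc : 𝒞 → 𝒞
      fb : ℬ → ℬ
      fs : 𝒮 → 𝒮
  open Relab public

  data Act (k : Calc) : Set where
    chan   : 𝒞 → Act k
    cochan : 𝒞 → Act k
    τ      : Act k
    snd    : HasB k → ℬ → Act k
    rcv    : HasB k → ℬ → Act k
    sig    : HasS k → 𝒮 → Act k

  data Lab (k : Calc) : Set where
    act   : Act k → Lab k
    disc  : HasD k → ℬ → Lab k       -- b:
    cosig : HasCo k → 𝒮 → Lab k      -- s̄

  relAct : ∀ {k} → Relab → Act k → Act k
  relAct f (chan c)    = chan (fc f c)
  relAct f (cochan c)  = cochan (fc f c)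
  relAct f τ           = τ
  relAct f (snd h b)   = snd h (fb f b)
  relAct f (rcv h b)   = rcv h (fb f b)
  relAct f (sig h s)   = sig h (fs f s)

  relLab : ∀ {k} → Relab → Lab k → Lab k
  relLab f (act α)     = act (relAct f α)
  relLab f (disc h b)  = disc h (fb f b)
  relLab f (cosig h s) = cosig h (fs f s)

  infixr 8 _∙_
  data Proc (k : Calc) : Set₁ where
    𝟎    : Proc k
    _∙_  : Act k → Proc k → Proc k
    _⊕_  : Proc k → Proc k → Proc k          -- P + Q
    _∥_  : Proc k → Proc k → Proc k
    _∖_  : Proc k → RSet k → Proc k
    _⟦_⟧ : Proc k → Relab → Proc k
    ident : 𝒜 → Proc k
    sg   : HasS k → Proc k → 𝒮 → Proc k     -- P ^ s

  Gd : ∀ {k} → Proc k → Set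
  Gd 𝟎          = ⊤
  Gd (α ∙ P)    = ⊤
  Gd (P ⊕ Q)    = Gd P × Gd Q
  Gd (P ∥ Q)    = Gd P × Gd Q
  Gd (P ∖ L)    = Gd P
  Gd (P ⟦ f ⟧)  = Gd P
  Gd (ident A)  = ⊥
  Gd (sg h P s) = Gd P

  -- recursive specifications are guarded in ABC and ABCd
  Guarded : (k : Calc) → (𝒜 → Proc k) → Set
  Guarded k spec = HasB k → ∀ A → Gd (spec A)

  Blocked : ∀ {k} → RSet k → Lab k → Set
  Blocked {k} L (act (chan c))   = InL k L (inj₁ c)
  Blocked {k} L (act (cochan c)) = InL k L (inj₁ c)
  Blocked {k} L (act (sig h s))  = InL k L (inj₂ s)
  Blocked {k} L (cosig h s)      = InL k L (inj₂ s)
  Blocked L (act τ)              = ⊥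
  Blocked L (act (snd h b))      = ⊥
  Blocked L (act (rcv h b))      = ⊥
  Blocked L (disc h b)           = ⊥

  -- η ranges over 𝒞 ∪ 𝒞̄ ∪ {τ} (ABC, ABCd), Act (CCS, CCSS), 𝓛 (CCSS′)
  ParOK : ∀ {k} → Lab k → Set
  ParOK (act (snd h b)) = ⊥
  ParOK (act (rcv h b)) = ⊥
  ParOK (disc h b)      = ⊥
  ParOK _               = ⊤

  data Compl {k} : Lab k → Lab k → Set where
    cc  : ∀ {c} → Compl (act (chan c)) (act (cochan c))
    cc′ : ∀ {c} → Compl (act (cochan c)) (act (chan c))
    ss  : ∀ {h h′ s} → Compl (act (sig h s)) (cosig h′ s)
    ss′ : ∀ {h h′ s} → Compl (cosig h′ s) (act (sig h s))

  -- broadcast modes ! ? :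
  data BM : Set where
    bang que col : BM

  data BLab {k} : Lab k → BM → ℬ → Set where
    bs : ∀ {h b} → BLab (act (snd h b)) bang b
    br : ∀ {h b} → BLab (act (rcv h b)) que b
    bd : ∀ {h b} → BLab (disc h b) col b

  data Comb : BM → BM → BM → Set where
    !? : Comb bang que bang
    ?! : Comb que bang bang
    ?? : Comb que que que
    !: : Comb bang col bang
    :! : Comb col bang bang
    ?: : Comb que col que
    :? : Comb col que que
    :: : Comb col col col

  NotRcv : ∀ {k} → ℬ → Act k → Set
  NotRcv b (rcv h b′) = ¬ (b′ ≡ b)
  NotRcv b _          = ⊤

  data Side : Set where
    Lf Rt : Side

  data Opp : Side → Side → Set where
    lr : Opp Lf Rt
    rl : Opp Rt Lf

  data Arg (k : Calc) : Set₁ where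
    plusA : Side → Arg k
    parA  : Side → Arg k
    resA  : RSet k → Arg k
    relA  : Relab → Arg k
    callA : 𝒜 → Arg k
    sigA  : 𝒮 → Arg k

  data Base (k : Calc) : Set₁ where
    pref  : Act k → Proc k → Base k
    emitB : Proc k → 𝒮 → Base k
    discB : ℬ → Base k

  Syn : Calc → Set₁
  Syn k = List (Arg k) × Base k

  _◂_ : ∀ {k} → Arg k → List (Syn k) → List (Syn k)
  a ◂ xs = map (λ x → (a ∷ proj₁ x , proj₂ x)) xs

  static : ∀ {k} → List (Arg k) → List (Arg k)
  static []            = []
  static (plusA _ ∷ σ) = static σ
  static (callA _ ∷ σ) = static σ
  static (sigA _ ∷ σ)  = static σ
  static (a ∷ σ)       = a ∷ static σ

  _|[_]_ : ∀ {k} → List (Arg k) → Side → Syn k → Syn k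
  σ |[ D ] x = (σ ++ parA D ∷ proj₁ x , proj₂ x)

  _⇝_ : ∀ {k} → Syn k → Syn k → Set₁
  x ⇝ x′ = (x′ ≡ x) ⊎
    Σ (List _) λ σ → Σ Side λ D → Σ (Syn _) λ x₂ →
      (x ≡ σ |[ D ] x₂) × (x′ ≡ static σ |[ D ] x₂)

  _⌣d_ : ∀ {k} → Syn k → Syn k → Set₁
  x ⌣d y = Σ (List _) λ σ → Σ Side λ D → Σ Side λ E →
    Σ (Syn _) λ x₂ → Σ (Syn _) λ y₂ →
      Opp D E × (x ≡ σ |[ D ] x₂) × (y ≡ σ |[ E ] y₂)

  _⌣_ : ∀ {k} → Syn k → Syn k → Set₁
  x ⌣ y = Σ (Syn _) λ x₀ → Σ (Syn _) λ y₀ → (x₀ ⇝ x) × (x₀ ⌣d y₀) × (y₀ ⇝ y)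

  actSyns : ∀ {k} → List (Syn k) → List (Syn k)
  actSyns [] = []
  actSyns ((σ , pref α P) ∷ xs) = (σ , pref α P) ∷ actSyns xs
  actSyns (_ ∷ xs) = actSyns xs

  sendSyns : ∀ {k} → List (Syn k) → List (Syn k)
  sendSyns [] = []
  sendSyns ((σ , pref (snd h b) P) ∷ xs) = (σ , pref (snd h b) P) ∷ sendSyns xs
  sendSyns (_ ∷ xs) = sendSyns xs

  -- semantics of calculus k with recursive specification A ≝ spec A

  module Sem (k : Calc) (spec : 𝒜 → Proc k) where

    -- Q has a b?-transition
    data HasRecv : ℬ → Proc k → Set₁ where
      pre  : ∀ {h b P} → HasRecv b (rcv h b ∙ P)
      sumL : ∀ {b P Q} → HasRecv b P → HasRecv b (P ⊕ Q)
      sumR : ∀ {b P Q} → HasRecv b Q → HasRecv b (P ⊕ Q)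
      parL : ∀ {b P Q} → HasRecv b P → HasRecv b (P ∥ Q)
      parR : ∀ {b P Q} → HasRecv b Q → HasRecv b (P ∥ Q)
      res  : ∀ {b P L} → HasRecv b P → HasRecv b (P ∖ L)
      rel  : ∀ {b c P f} → HasRecv c P → fb f c ≡ b → HasRecv b (P ⟦ f ⟧)
      call : ∀ {b A} → HasRecv b (spec A) → HasRecv b (ident A)
      sgop : ∀ {b h P r} → HasRecv b P → HasRecv b (sg h P r)

    -- emission derivations of P ↷ s (CCSS)
    data Emit : Proc k → 𝒮 → Set₁ where
      ax   : IsCCSS k → ∀ {h P s} → Emit (sg h P s) s
      sumL : ∀ {P Q s} → Emit P s → Emit (P ⊕ Q) s
      sumR : ∀ {P Q s} → Emit Q s → Emit (P ⊕ Q) s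
      parL : ∀ {P Q s} → Emit P s → Emit (P ∥ Q) s
      parR : ∀ {P Q s} → Emit Q s → Emit (P ∥ Q) s
      sgop : ∀ {h P s r} → Emit P s → Emit (sg h P r) s
      res  : ∀ {P s L} → Emit P s → ¬ InL k L (inj₂ s) → Emit (P ∖ L) s
      rel  : ∀ {P s f} → Emit P s → Emit (P ⟦ f ⟧) (fs f s)
      call : ∀ {A s} → Emit (spec A) s → Emit (ident A) s

    data Der : Proc k → Lab k → Proc k → Set₁ where
      pre   : ∀ {α P} → Der (α ∙ P) (act α) P
      sumL  : ∀ {α P P′ Q} → Der P (act α) P′ → Der (P ⊕ Q) (act α) P′
      sumR  : ∀ {α P Q Q′} → Der Q (act α) Q′ → Der (P ⊕ Q) (act α) Q′
      parL  : ∀ {ℓ P P′ Q} → Der P ℓ P′ → ParOK ℓ → Der (P ∥ Q) ℓ (P′ ∥ Q)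
      parR  : ∀ {ℓ P Q Q′} → Der Q ℓ Q′ → ParOK ℓ → Der (P ∥ Q) ℓ (P ∥ Q′)
      comm  : ∀ {ℓ₁ ℓ₂ P P′ Q Q′} → Der P ℓ₁ P′ → Der Q ℓ₂ Q′ → Compl ℓ₁ ℓ₂ →
              Der (P ∥ Q) (act τ) (P′ ∥ Q′)
      res   : ∀ {ℓ P P′ L} → Der P ℓ P′ → ¬ Blocked L ℓ → Der (P ∖ L) ℓ (P′ ∖ L)
      rel   : ∀ {ℓ P P′ f} → Der P ℓ P′ → Der (P ⟦ f ⟧) (relLab f ℓ) (P′ ⟦ f ⟧)
      call  : ∀ {α A P′} → Der (spec A) (act α) P′ → Der (ident A) (act α) P′
      -- ABC: broadcast past a non-receiving component
      bsideL : IsABC k → ∀ {ℓ m b P P′ Q} → Der P ℓ P′ → BLab ℓ m b →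
               ¬ HasRecv b Q → Der (P ∥ Q) ℓ (P′ ∥ Q)
      bsideR : IsABC k → ∀ {ℓ m b P Q Q′} → Der Q ℓ Q′ → BLab ℓ m b →
               ¬ HasRecv b P → Der (P ∥ Q) ℓ (P ∥ Q′)
      bsync : ∀ {ℓ₁ ℓ₂ ℓ m₁ m₂ m b P P′ Q Q′} → Der P ℓ₁ P′ → Der Q ℓ₂ Q′ →
              BLab ℓ₁ m₁ b → BLab ℓ₂ m₂ b → Comb m₁ m₂ m → BLab ℓ m b →
              Der (P ∥ Q) ℓ (P′ ∥ Q′)
      disc0   : ∀ {h b} → Der 𝟎 (disc h b) 𝟎
      discPre : ∀ {h b α P} → NotRcv b α → Der (α ∙ P) (disc h b) (α ∙ P)
      discSum : ∀ {h b P P′ Q Q′} → Der P (disc h b) P′ → Der Q (disc h b) Q′ →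
                Der (P ⊕ Q) (disc h b) (P′ ⊕ Q′)
      discCall : ∀ {h b A P′} → Der (spec A) (disc h b) P′ →
                 Der (ident A) (disc h b) (ident A)
      sgop  : ∀ {h α P P′ r} → Der P (act α) P′ → Der (sg h P r) (act α) P′
      -- CCSS: signal reading
      sigL  : ∀ {h s P Q Q′} → Emit P s → Der Q (act (sig h s)) Q′ →
              Der (P ∥ Q) (act τ) (P ∥ Q′)
      sigR  : ∀ {h s P P′ Q} → Der P (act (sig h s)) P′ → Emit Q s →
              Der (P ∥ Q) (act τ) (P′ ∥ Q)
      -- CCSS′: emission transitions
      emit    : ∀ {h h′ P s} → Der (sg h P s) (cosig h′ s) (sg h P s)
      coSumL  : ∀ {h s P P′ Q} → Der P (cosig h s) P′ → Der (P ⊕ Q) (cosig h s) (P′ ⊕ Q)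
      coSumR  : ∀ {h s P Q Q′} → Der Q (cosig h s) Q′ → Der (P ⊕ Q) (cosig h s) (P ⊕ Q′)
      coSg    : ∀ {h h′ s P P′ r} → Der P (cosig h s) P′ →
                Der (sg h′ P r) (cosig h s) (sg h′ P′ r)
      coCall  : ∀ {h s A P′} → Der (spec A) (cosig h s) P′ →
                Der (ident A) (cosig h s) (ident A)

    ςE : ∀ {P s} → Emit P s → List (Syn k)
    ςE (ax _ {P = P} {s}) = ([] , emitB P s) ∷ []
    ςE (sumL e)  = plusA Lf ◂ ςE e
    ςE (sumR e)  = plusA Rt ◂ ςE e
    ςE (parL e)  = parA Lf ◂ ςE e
    ςE (parR e)  = parA Rt ◂ ςE e
    ςE (sgop {r = r} e) = sigA r ◂ ςE e
    ςE (res {L = L} e _) = resA L ◂ ςE e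
    ςE (rel {f = f} e) = relA f ◂ ςE e
    ςE (call {A = A} e) = callA A ◂ ςE e

    ς : ∀ {P ℓ P′} → Der P ℓ P′ → List (Syn k)
    ς (pre {α} {P}) = ([] , pref α P) ∷ []
    ς (sumL χ) = plusA Lf ◂ ς χ
    ς (sumR χ) = plusA Rt ◂ ς χ
    ς (parL χ _) = parA Lf ◂ ς χ
    ς (parR χ _) = parA Rt ◂ ς χ
    ς (comm χ ζ _) = (parA Lf ◂ ς χ) ++ (parA Rt ◂ ς ζ)
    ς (res {L = L} χ _) = resA L ◂ ς χ
    ς (rel {f = f} χ) = relA f ◂ ς χ
    ς (call {A = A} χ) = callA A ◂ ς χ
    ς (bsideL _ χ _ _) = parA Lf ◂ ς χ
    ς (bsideR _ χ _ _) = parA Rt ◂ ς χ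
    ς (bsync χ ζ _ _ _ _) = (parA Lf ◂ ς χ) ++ (parA Rt ◂ ς ζ)
    ς (disc0 {b = b}) = ([] , discB b) ∷ []
    ς (discPre {b = b} _) = ([] , discB b) ∷ []
    ς (discSum χ υ) = (plusA Lf ◂ ς χ) ++ (plusA Rt ◂ ς υ)
    ς (discCall {A = A} χ) = callA A ◂ ς χ
    ς (sgop {r = r} χ) = sigA r ◂ ς χ
    ς (sigL e ζ) = (parA Lf ◂ ςE e) ++ (parA Rt ◂ ς ζ)
    ς (sigR χ e) = (parA Lf ◂ ς χ) ++ (parA Rt ◂ ςE e)
    ς (emit {P = P} {s}) = ([] , emitB P s) ∷ []
    ς (coSumL χ) = plusA Lf ◂ ς χ
    ς (coSumR χ) = plusA Rt ◂ ς χ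
    ς (coSg {r = r} χ) = sigA r ◂ ς χ
    ς (coCall {A = A} χ) = callA A ◂ ς χ

    Tr : Set₁
    Tr = Σ (Proc k) λ P → Σ (Lab k) λ ℓ → Σ (Proc k) λ P′ → Der P ℓ P′

    aς : Tr → List (Syn k)
    aς (_ , _ , _ , ζ) = actSyns (ς ζ)

    -- labels allowed in Tr^{s•}: everything but b? and b:
    SGood : Lab k → Set
    SGood (act (rcv h b)) = ⊥
    SGood (disc h b)      = ⊥
    SGood _               = ⊤

    data TrS : Set₁ where
      trS : ∀ {P ℓ P′} → Der P ℓ P′ → SGood ℓ → TrS
      emS : ∀ {P s} → Emit P s → TrS

    nsel : Lab k → List (Syn k) → List (Syn k)
    nsel (act (snd h b)) xs = sendSyns xs
    nsel _ xs = xs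

    nς : TrS → List (Syn k)
    nς (trS {ℓ = ℓ} χ _) = nsel ℓ (ς χ)
    nς (emS e) = ςE e

    _⇝T_ : TrS → TrS → Set₁
    t ⇝T t′ = (length (nς t) ≡ length (nς t′)) ×
      (∀ x′ → x′ ∈ nς t′ → Σ (Syn k) λ x → (x ∈ nς t) × (x ⇝ x′))

    _⌣•_ : TrS → Tr → Set₁
    t ⌣• ζ = ∀ x y → x ∈ nς t → y ∈ aς ζ → x ⌣ y

module Submission where

-- A weakening step x ⇝ x′ on synchrons erases the dynamic arguments
-- (+_L, +_R, A:, ^r) in front of one parallel-composition argument |_D.  Since x ⌣ y is defined as x₀ ⇝ x, x₀ ⌣d y₀, y₀ ⇝ y, it
-- suffices to show that ⇝ is transitive on synchrons: then every synchron
-- x′ of t′, which weakens some synchron x of t, inherits x's witness x₀.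
--
-- Transitivity rests on two facts.  First, erasure is idempotent and
-- distributes over concatenation.  Second, if the (already static) prefix
-- erased by the first step is cut by the second step at a |-argument,
-- then either the second cut lies inside that static prefix, in which case
-- the second step changes nothing, or it lies beyond the first cut, in
-- which case both steps combine into a single erasure up to the later cut.

open import Defs
open import Data.Sum using (_⊎_; inj₁; inj₂)
open import Data.Product using (Σ; _×_; _,_)
open import Data.Product.Properties using (,-injectiveˡ; ,-injectiveʳ)
open import Data.List using (List; []; _∷_; _++_)
open import Data.List.Properties using (∷-injective; ++-assoc)
open import Relation.Binary.PropositionalEquality
open ≡-Reasoning

middle-split : ∀ {a} {A : Set a} (α γ : List A) {p q : A} {β δ : List A} →
  α ++ p ∷ β ≡ γ ++ q ∷ δ →
  (Σ (List A) λ ρ → α ≡ γ ++ ρ) ⊎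
  (Σ (List A) λ ρ → (γ ≡ α ++ p ∷ ρ) × (β ≡ ρ ++ q ∷ δ))
middle-split α [] _ = inj₁ (α , refl)
middle-split [] (c ∷ γ) eq with ∷-injective eq
... | refl , β≡ = inj₂ (γ , refl , β≡)
middle-split (a ∷ α) (c ∷ γ) eq with ∷-injective eq
... | refl , eq′ with middle-split α γ eq′
... | inj₁ (ρ , α≡) = inj₁ (ρ , cong (a ∷_) α≡)
... | inj₂ (ρ , γ≡ , β≡) = inj₂ (ρ , cong (a ∷_) γ≡ , β≡)

module Weakening (𝒜 𝒞 ℬ 𝒮 : Set) {k : Calc} where

  Args : Set₁
  Args = List (Arg 𝒜 𝒞 ℬ 𝒮 k)

  erase : Args → Args
  erase = static 𝒜 𝒞 ℬ 𝒮

  _↝_ : Syn 𝒜 𝒞 ℬ 𝒮 k → Syn 𝒜 𝒞 ℬ 𝒮 k → Set₁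
  x ↝ x′ = _⇝_ 𝒜 𝒞 ℬ 𝒮 x x′

  data Static : Args → Set₁ where
    []   : Static []
    par∷ : ∀ {D σ} → Static σ → Static (parA D ∷ σ)
    res∷ : ∀ {L σ} → Static σ → Static (resA L ∷ σ)
    rel∷ : ∀ {f σ} → Static σ → Static (relA f ∷ σ)

  erase-Static : ∀ σ → Static (erase σ)
  erase-Static []            = []
  erase-Static (plusA _ ∷ σ) = erase-Static σ
  erase-Static (parA _ ∷ σ)  = par∷ (erase-Static σ)
  erase-Static (resA _ ∷ σ)  = res∷ (erase-Static σ)
  erase-Static (relA _ ∷ σ)  = rel∷ (erase-Static σ)
  erase-Static (callA _ ∷ σ) = erase-Static σ
  erase-Static (sigA _ ∷ σ)  = erase-Static σ

  erase-fixes-Static : ∀ {σ} → Static σ → erase σ ≡ σ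
  erase-fixes-Static []        = refl
  erase-fixes-Static (par∷ st) = cong (_ ∷_) (erase-fixes-Static st)
  erase-fixes-Static (res∷ st) = cong (_ ∷_) (erase-fixes-Static st)
  erase-fixes-Static (rel∷ st) = cong (_ ∷_) (erase-fixes-Static st)

  Static-prefix : ∀ γ {ρ} → Static (γ ++ ρ) → Static γ
  Static-prefix []       _         = []
  Static-prefix (_ ∷ γ) (par∷ st) = par∷ (Static-prefix γ st)
  Static-prefix (_ ∷ γ) (res∷ st) = res∷ (Static-prefix γ st)
  Static-prefix (_ ∷ γ) (rel∷ st) = rel∷ (Static-prefix γ st)

  erase-++ : ∀ σ ρ → erase (σ ++ ρ) ≡ erase σ ++ erase ρ
  erase-++ []            ρ = refl
  erase-++ (plusA _ ∷ σ) ρ = erase-++ σ ρ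
  erase-++ (parA _ ∷ σ)  ρ = cong (_ ∷_) (erase-++ σ ρ)
  erase-++ (resA _ ∷ σ)  ρ = cong (_ ∷_) (erase-++ σ ρ)
  erase-++ (relA _ ∷ σ)  ρ = cong (_ ∷_) (erase-++ σ ρ)
  erase-++ (callA _ ∷ σ) ρ = erase-++ σ ρ
  erase-++ (sigA _ ∷ σ)  ρ = erase-++ σ ρ

  erase-absorb : ∀ σ ρ → erase (erase σ ++ ρ) ≡ erase (σ ++ ρ)
  erase-absorb σ ρ = begin
    erase (erase σ ++ ρ)          ≡⟨ erase-++ (erase σ) ρ ⟩
    erase (erase σ) ++ erase ρ    ≡⟨ cong (_++ erase ρ) (erase-fixes-Static (erase-Static σ)) ⟩
    erase σ ++ erase ρ            ≡⟨ erase-++ σ ρ ⟨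
    erase (σ ++ ρ)                ∎

  ↝-trans : ∀ {x₀ x x′} → x₀ ↝ x → x ↝ x′ → x₀ ↝ x′
  ↝-trans (inj₁ refl) q = q
  ↝-trans p (inj₁ refl) = p
  ↝-trans (inj₂ (σ₁ , D , (β , b) , refl , refl)) (inj₂ (σ₂ , E , (δ , b′) , eq , refl))
    with ,-injectiveʳ eq
  ... | refl with middle-split (erase σ₁) σ₂ (,-injectiveˡ eq)
  -- the second cut lies in the static prefix erase σ₁: nothing more is erased
  ... | inj₁ (ρ , erased≡) =
    inj₂ (σ₁ , D , (β , b) , refl , (begin
      (erase σ₂ ++ parA E ∷ δ , b)   ≡⟨ cong (λ σ → σ ++ parA E ∷ δ , b) (erase-fixes-Static σ₂-static) ⟩
      (σ₂ ++ parA E ∷ δ , b)         ≡⟨ eq ⟨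
      (erase σ₁ ++ parA D ∷ β , b)   ∎))
    where
      σ₂-static : Static σ₂
      σ₂-static = Static-prefix σ₂ (subst Static erased≡ (erase-Static σ₁))
  -- the second cut lies beyond the first: erase everything up to it at once
  ... | inj₂ (ρ , refl , refl) =
    inj₂ (σ₁ ++ parA D ∷ ρ , E , (δ , b)
         , cong (_, b) (sym (++-assoc σ₁ (parA D ∷ ρ) (parA E ∷ δ)))
         , cong (λ σ → σ ++ parA E ∷ δ , b) (erase-absorb σ₁ (parA D ∷ ρ)))

  ⌣-weaken : ∀ {x x′ y} → x ↝ x′ → _⌣_ 𝒜 𝒞 ℬ 𝒮 x y → _⌣_ 𝒜 𝒞 ℬ 𝒮 x′ y
  ⌣-weaken x↝x′ (x₀ , y₀ , x₀↝x , x₀⌣dy₀ , y₀↝y) =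
    x₀ , y₀ , ↝-trans x₀↝x x↝x′ , x₀⌣dy₀ , y₀↝y

-- every synchron of t′ weakens a synchron of t, which is concurrent with
-- every action synchron of v
proposition4 : (𝒜 𝒞 ℬ 𝒮 : Set) (k : Calc) (spec : 𝒜 → Proc 𝒜 𝒞 ℬ 𝒮 k) →
    Guarded 𝒜 𝒞 ℬ 𝒮 k spec →
    (t t′ : Sem.TrS 𝒜 𝒞 ℬ 𝒮 k spec) (v : Sem.Tr 𝒜 𝒞 ℬ 𝒮 k spec) →
    Sem._⇝T_ 𝒜 𝒞 ℬ 𝒮 k spec t t′ →
    Sem._⌣•_ 𝒜 𝒞 ℬ 𝒮 k spec t v →
    Sem._⌣•_ 𝒜 𝒞 ℬ 𝒮 k spec t′ v
proposition4 𝒜 𝒞 ℬ 𝒮 k spec _ t t′ v (_ , weakens) t⌣v x′ y x′∈t′ y∈v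
  with weakens x′ x′∈t′
... | x , x∈t , x↝x′ = Weakening.⌣-weaken 𝒜 𝒞 ℬ 𝒮 x↝x′ (t⌣v x y x∈t y∈v)
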